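{- Let $\mathbb{Q}=(\Omega,\leq,\otimes,\mathsf{k})$ be a Lawverian quantale and let $(A,R)$ be a $\mathbb{Q}$-abstract rewriting system, i.e. $A$ is a set and $R\colon A\times A\to\Omega$. Then $R$ is confluent if and only if $R$ is Church–Rosser, i.e. if and only if $R^{\equiv}=R^{*};(R^{*})^{ - }$.
   Context: A quantale $\mathbb{Q}=(\Omega,\leq,\otimes,\mathsf{k})$ is a complete lattice $(\Omega,\leq)$ with a monoid structure $(\Omega,\otimes,\mathsf{k})$ such that $\otimes$ distributes over arbitrary joins in each argument. It is Lawverian if it is commutative, integral ($\mathsf{k}$ is the top element), cointegral ($\varepsilon\otimes\delta=\bot$ implies $\varepsilon=\bot$ or $\delta=\bot$) and non-trivial ($\mathsf{k}\neq\bot$). A $\mathbb{Q}$-relation $R\colon A\times B\to\Omega$; such relations are ordered and joined pointwise. Composition: $(R;S)(a,c)=\bigvee_{b}R(a,b)\otimes S(b,c)$. Identity: $\Delta(a,a)=\mathsf{k}$ and $\Delta(a,b)=\bot$ for $a\neq b$. Transpose: $R^{ - }(b,a)=R(a,b)$. Iterates: $R^0=\Delta$, $R^{n+1}=R;R^n$; $R^{*}=\bigvee_{n\geq 0}R^n$; $R^{\equiv}=(R\vee R^{ - })^{*}$. $R$ has the diamond property if $R^{ - };R\leq R;R^{ - }$. $R$ is confluent if $R^{*}$ has the diamond property. -}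

module Defs where

open import Level using (0ℓ)
open import Data.Nat using (ℕ; zero; suc)
open import Data.Bool using (Bool; true; false)
open import Data.Empty using (⊥)
open import Data.Sum using (_⊎_)
open import Relation.Nullary using (¬_)
open import Relation.Binary.PropositionalEquality using (_≡_)
open import Relation.Binary.Structures using (IsPartialOrder)

record Quantale : Set₁ where
  infixl 7 _⊗_
  field
    Ω          : Set
    _≤_        : Ω → Ω → Set
    isPartialOrder : IsPartialOrder _≡_ _≤_
    ⋁          : {I : Set} → (I → Ω) → Ω
    ⋁-upper    : {I : Set} (f : I → Ω) (i : I) → f i ≤ ⋁ f
    ⋁-least    : {I : Set} (f : I → Ω) (x : Ω) → ((i : I) → f i ≤ x) → ⋁ f ≤ x
    _⊗_        : Ω → Ω → Ω
    k          : Ω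
    ⊗-assoc    : (x y z : Ω) → (x ⊗ y) ⊗ z ≡ x ⊗ (y ⊗ z)
    ⊗-identityˡ : (x : Ω) → k ⊗ x ≡ x
    ⊗-identityʳ : (x : Ω) → x ⊗ k ≡ x
    ⊗-distribˡ-⋁ : {I : Set} (x : Ω) (f : I → Ω) → x ⊗ ⋁ f ≡ ⋁ (λ i → x ⊗ f i)
    ⊗-distribʳ-⋁ : {I : Set} (f : I → Ω) (x : Ω) → ⋁ f ⊗ x ≡ ⋁ (λ i → f i ⊗ x)

  ⊥Ω : Ω
  ⊥Ω = ⋁ {⊥} (λ ())

record IsLawverian (Q : Quantale) : Set where
  open Quantale Q
  field
    commutative : (x y : Ω) → x ⊗ y ≡ y ⊗ x
    integral    : (x : Ω) → x ≤ k
    cointegral  : (ε δ : Ω) → ε ⊗ δ ≡ ⊥Ω → (ε ≡ ⊥Ω) ⊎ (δ ≡ ⊥Ω)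
    nontrivial  : ¬ (k ≡ ⊥Ω)

module _ (Q : Quantale) where
  open Quantale Q

  QRel : Set → Set
  QRel A = A → A → Ω

  module _ {A : Set} where
    infixr 6 _⨾_
    infixr 5 _∨ᴿ_

    _⨾_ : QRel A → QRel A → QRel A
    (R ⨾ S) a c = ⋁ {A} (λ b → R a b ⊗ S b c)

    -- identity relation: Δ(a,b) = ⋁_{p : a ≡ b} k  (= k if a = b, ⊥ otherwise)
    Δ : QRel A
    Δ a b = ⋁ {a ≡ b} (λ _ → k)

    _⁻ : QRel A → QRel A
    (R ⁻) a b = R b a

    _∨ᴿ_ : QRel A → QRel A → QRel A
    (R ∨ᴿ S) a b = ⋁ {Bool} (λ { true → R a b ; false → S a b })

    _^_ : QRel A → ℕ → QRel A
    R ^ zero  = Δ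
    R ^ suc n = R ⨾ (R ^ n)

    _* : QRel A → QRel A
    (R *) a b = ⋁ {ℕ} (λ n → (R ^ n) a b)

    _≡* : QRel A → QRel A
    R ≡* = (R ∨ᴿ (R ⁻)) *

    Diamond : QRel A → Set
    Diamond R = (a b : A) → ((R ⁻) ⨾ R) a b ≤ (R ⨾ (R ⁻)) a b

    Confluent : QRel A → Set
    Confluent R = Diamond (R *)

    ChurchRosser : QRel A → Set
    ChurchRosser R = (a b : A) → (R ≡*) a b ≡ ((R *) ⨾ ((R *) ⁻)) a b

-- The equivalence closure R^≡ always contains the joinability relation
-- R*;(R*)⁻, and R* ⊆ R^≡ with R^≡ symmetric gives (R*)⁻;R* ⊆ R^≡; so
-- Church–Rosser makes the peaks (R*)⁻;R* joinable, i.e. R is confluent.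
-- Conversely, if R* has the diamond property then R*;(R*)⁻ is transitive;
-- being also reflexive and containing R ∨ R⁻, it contains the least such
-- relation R^≡.
module Submission where

open import Defs
open import Function.Bundles using (_⇔_; mk⇔)
open import Data.Nat using (ℕ; zero; suc; _+_)
open import Data.Bool using (Bool; true; false)
open import Relation.Binary.PropositionalEquality using (_≡_; refl; sym; trans; cong; subst)
open import Relation.Binary.Structures using (IsPartialOrder)

module QuantaleProperties (Q : Quantale) where
  open Quantale Q renaming (_≤_ to infix 4 _≤_)
  open IsPartialOrder isPartialOrder public
    using (antisym) renaming (refl to ≤-refl; trans to ≤-trans; reflexive to ≤-reflexive)

  ≤-⋁ : {I : Set} {f : I → Ω} {x : Ω} (i : I) → x ≤ f i → x ≤ ⋁ f
  ≤-⋁ {f = f} i x≤fi = ≤-trans x≤fi (⋁-upper f i)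

  ⊗⋁-least : {I : Set} {x : Ω} {f : I → Ω} {z : Ω} → ((i : I) → x ⊗ f i ≤ z) → x ⊗ ⋁ f ≤ z
  ⊗⋁-least {x = x} {f} {z} h = subst (_≤ z) (sym (⊗-distribˡ-⋁ x f)) (⋁-least _ z h)

  ⋁⊗-least : {I : Set} {x : Ω} {f : I → Ω} {z : Ω} → ((i : I) → f i ⊗ x ≤ z) → ⋁ f ⊗ x ≤ z
  ⋁⊗-least {x = x} {f} {z} h = subst (_≤ z) (sym (⊗-distribʳ-⋁ f x)) (⋁-least _ z h)

  -- Monotonicity comes from distributivity over the two-element join x ∨ y = y.
  private
    pair : Ω → Ω → Bool → Ω
    pair x y true  = x
    pair x y false = y

    ⋁-pair : {x y : Ω} → x ≤ y → ⋁ (pair x y) ≡ y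
    ⋁-pair {x} {y} x≤y = antisym (⋁-least _ y bounded) (⋁-upper (pair x y) false)
      where
      bounded : (i : Bool) → pair x y i ≤ y
      bounded true  = x≤y
      bounded false = ≤-refl

  ⊗-monoˡ : {x y z : Ω} → x ≤ y → x ⊗ z ≤ y ⊗ z
  ⊗-monoˡ {x} {y} {z} x≤y = subst (λ w → x ⊗ z ≤ w ⊗ z) (⋁-pair x≤y)
    (subst (x ⊗ z ≤_) (sym (⊗-distribʳ-⋁ (pair x y) z)) (⋁-upper (λ i → pair x y i ⊗ z) true))

  ⊗-monoʳ : {x y z : Ω} → x ≤ y → z ⊗ x ≤ z ⊗ y
  ⊗-monoʳ {x} {y} {z} x≤y = subst (λ w → z ⊗ x ≤ z ⊗ w) (⋁-pair x≤y)
    (subst (z ⊗ x ≤_) (sym (⊗-distribˡ-⋁ z (pair x y))) (⋁-upper (λ i → z ⊗ pair x y i) true))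

  ⊗-mono : {x y u v : Ω} → x ≤ y → u ≤ v → x ⊗ u ≤ y ⊗ v
  ⊗-mono x≤y u≤v = ≤-trans (⊗-monoˡ x≤y) (⊗-monoʳ u≤v)

module RelationProperties (Q : Quantale) {A : Set} where
  open Quantale Q renaming (_≤_ to infix 4 _≤_)
  open QuantaleProperties Q

  infix 4 _⊆_
  _⊆_ : QRel Q A → QRel Q A → Set
  S ⊆ T = (a b : A) → S a b ≤ T a b

  Reflexive : QRel Q A → Set
  Reflexive T = (a : A) → k ≤ T a a

  Transitive : QRel Q A → Set
  Transitive T = (a b c : A) → T a b ⊗ T b c ≤ T a c

  Δ-reflexive : Reflexive (Δ Q)
  Δ-reflexive a = ≤-⋁ refl ≤-refl

  Δ⊆-reflexive : {T : QRel Q A} → Reflexive T → Δ Q ⊆ T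
  Δ⊆-reflexive {T} T-refl a b = ⋁-least _ (T a b) λ { refl → T-refl a }

  Δ⊗-least : {a b : A} {x z : Ω} → (a ≡ b → x ≤ z) → Δ Q a b ⊗ x ≤ z
  Δ⊗-least {x = x} {z} h = ⋁⊗-least λ a≡b → subst (_≤ z) (sym (⊗-identityˡ x)) (h a≡b)

  module _ (S : QRel Q A) where

    ^-+ : (m n : ℕ) (a b c : A) → _^_ Q S m a b ⊗ _^_ Q S n b c ≤ _^_ Q S (m + n) a c
    ^-+ zero    n a b c = Δ⊗-least λ { refl → ≤-refl }
    ^-+ (suc m) n a b c = ⋁⊗-least λ d →
      ≤-trans (≤-reflexive (⊗-assoc _ _ _)) (≤-⋁ d (⊗-monoʳ (^-+ m n d b c)))

    *-transitive : Transitive (_* Q S)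
    *-transitive a b c = ⋁⊗-least λ m → ⊗⋁-least λ n → ≤-⋁ (m + n) (^-+ m n a b c)

    *-reflexive : Reflexive (_* Q S)
    *-reflexive a = ≤-⋁ 0 (Δ-reflexive a)

    ⊆* : S ⊆ _* Q S
    ⊆* a b = ≤-⋁ 1 (≤-⋁ b (≤-trans (≤-reflexive (sym (⊗-identityʳ _))) (⊗-monoʳ (Δ-reflexive b))))

    *-least : {T : QRel Q A} → S ⊆ T → Reflexive T → Transitive T → _* Q S ⊆ T
    *-least {T} S⊆T T-refl T-trans a b = ⋁-least _ (T a b) λ n → ^⊆ n a b
      where
      ^⊆ : (n : ℕ) → _^_ Q S n ⊆ T
      ^⊆ zero    = Δ⊆-reflexive T-refl
      ^⊆ (suc n) a b = ⋁-least _ (T a b) λ d →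
        ≤-trans (⊗-mono (S⊆T a d) (^⊆ n d b)) (T-trans a d b)

  module Commutative (⊗-comm : (x y : Ω) → x ⊗ y ≡ y ⊗ x) where

    ⁻-transitive : {T : QRel Q A} → Transitive T → Transitive (_⁻ Q T)
    ⁻-transitive {T} T-trans a b c = subst (_≤ T c a) (⊗-comm _ _) (T-trans c b a)

    ⨾⁻-reflexive : {S : QRel Q A} → Reflexive S → Reflexive (_⨾_ Q S (_⁻ Q S))
    ⨾⁻-reflexive S-refl a =
      ≤-⋁ a (≤-trans (≤-reflexive (sym (⊗-identityˡ k))) (⊗-mono (S-refl a) (S-refl a)))

    ⊆⨾⁻ : {S T : QRel Q A} → Reflexive T → S ⊆ T → S ⊆ _⨾_ Q T (_⁻ Q T)
    ⊆⨾⁻ T-refl S⊆T a b =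
      ≤-⋁ b (≤-trans (≤-reflexive (sym (⊗-identityʳ _))) (⊗-mono (S⊆T a b) (T-refl b)))

    ⁻⊆⨾⁻ : {S T : QRel Q A} → Reflexive T → S ⊆ T → _⁻ Q S ⊆ _⨾_ Q T (_⁻ Q T)
    ⁻⊆⨾⁻ T-refl S⊆T a b =
      ≤-⋁ a (≤-trans (≤-reflexive (sym (⊗-identityˡ _))) (⊗-mono (T-refl a) (S⊆T b a)))

    -- Fill the inner peak S b d ⊗ S b e with a valley S d f ⊗ S e f, then
    -- compose S a d ⊗ S d f and S c e ⊗ S e f.
    diamond⇒⨾⁻-transitive : {S : QRel Q A} → Transitive S → Diamond Q S
      → Transitive (_⨾_ Q S (_⁻ Q S))
    diamond⇒⨾⁻-transitive {S} S-trans S-diamond a b c =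
      ⋁⊗-least λ d → ⊗⋁-least λ e → subst (_≤ Join a c) (sym (regroup _ _ _ _))
        (≤-trans (⊗-monoˡ (⊗-monoʳ (≤-trans (≤-⋁ b ≤-refl) (S-diamond d e))))
          (close-valley d e))
      where
      Join : QRel Q A
      Join = _⨾_ Q S (_⁻ Q S)

      regroup : (x y z w : Ω) → (x ⊗ y) ⊗ (z ⊗ w) ≡ (x ⊗ (y ⊗ z)) ⊗ w
      regroup x y z w = trans (sym (⊗-assoc (x ⊗ y) z w)) (cong (_⊗ w) (⊗-assoc x y z))

      interchange : (x y z w : Ω) → (x ⊗ (y ⊗ z)) ⊗ w ≡ (x ⊗ y) ⊗ (w ⊗ z)
      interchange x y z w = trans (cong (_⊗ w) (sym (⊗-assoc x y z)))
        (trans (⊗-assoc (x ⊗ y) z w) (cong ((x ⊗ y) ⊗_) (⊗-comm z w)))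

      close-valley : (d e : A) → S a d ⊗ Join d e ⊗ S c e ≤ Join a c
      close-valley d e = subst (λ v → v ⊗ S c e ≤ Join a c) (sym (⊗-distribˡ-⋁ (S a d) _))
        (⋁⊗-least λ f → subst (_≤ Join a c) (sym (interchange _ _ _ _))
          (≤-⋁ f (⊗-mono (S-trans a d f) (S-trans c e f))))

module ChurchRosserProof (Q : Quantale) {A : Set}
  (⊗-comm : (x y : Quantale.Ω Q) → Quantale._⊗_ Q x y ≡ Quantale._⊗_ Q y x)
  (R : QRel Q A) where
  open Quantale Q renaming (_≤_ to infix 4 _≤_)
  open QuantaleProperties Q
  open RelationProperties Q {A}
  open Commutative ⊗-comm

  R* R∨R⁻ R≡ Joinable : QRel Q A
  R*       = _* Q R
  R∨R⁻     = _∨ᴿ_ Q R (_⁻ Q R)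
  R≡       = _≡* Q R
  Joinable = _⨾_ Q R* (_⁻ Q R*)

  ⊆R∨R⁻ : R ⊆ R∨R⁻
  ⊆R∨R⁻ a b = ≤-⋁ true ≤-refl

  ⁻⊆R∨R⁻ : _⁻ Q R ⊆ R∨R⁻
  ⁻⊆R∨R⁻ a b = ≤-⋁ false ≤-refl

  R≡-symmetric : R≡ ⊆ _⁻ Q R≡
  R≡-symmetric = *-least R∨R⁻ swap (*-reflexive R∨R⁻) (⁻-transitive (*-transitive R∨R⁻))
    where
    swap : R∨R⁻ ⊆ _⁻ Q R≡
    swap a b = ⋁-least _ _ λ
      { true  → ≤-trans (⁻⊆R∨R⁻ b a) (⊆* R∨R⁻ b a)
      ; false → ≤-trans (⊆R∨R⁻ b a) (⊆* R∨R⁻ b a) }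

  R*⊆R≡ : R* ⊆ R≡
  R*⊆R≡ = *-least R (λ a b → ≤-trans (⊆R∨R⁻ a b) (⊆* R∨R⁻ a b))
    (*-reflexive R∨R⁻) (*-transitive R∨R⁻)

  Joinable⊆R≡ : Joinable ⊆ R≡
  Joinable⊆R≡ a b = ⋁-least _ _ λ c →
    ≤-trans (⊗-mono (R*⊆R≡ a c) (≤-trans (R*⊆R≡ b c) (R≡-symmetric b c)))
      (*-transitive R∨R⁻ a c b)

  confluent⇒R≡⊆Joinable : Confluent Q R → R≡ ⊆ Joinable
  confluent⇒R≡⊆Joinable conf = *-least R∨R⁻ R∨R⁻⊆Joinable
    (⨾⁻-reflexive (*-reflexive R))
    (diamond⇒⨾⁻-transitive (*-transitive R) conf)
    where
    R∨R⁻⊆Joinable : R∨R⁻ ⊆ Joinable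
    R∨R⁻⊆Joinable a b = ⋁-least _ _ λ
      { true  → ⊆⨾⁻ (*-reflexive R) (⊆* R) a b
      ; false → ⁻⊆⨾⁻ (*-reflexive R) (⊆* R) a b }

  confluent⇒churchRosser : Confluent Q R → ChurchRosser Q R
  confluent⇒churchRosser conf a b =
    antisym (confluent⇒R≡⊆Joinable conf a b) (Joinable⊆R≡ a b)

  churchRosser⇒confluent : ChurchRosser Q R → Confluent Q R
  churchRosser⇒confluent cr a b = ⋁-least _ _ λ c → subst (R* c a ⊗ R* c b ≤_) (cr a b)
    (≤-trans (⊗-mono (≤-trans (R*⊆R≡ c a) (R≡-symmetric c a)) (R*⊆R≡ c b))
      (*-transitive R∨R⁻ a c b))

mainTheorem1 : (Q : Quantale) → IsLawverian Q → {A : Set} (R : QRel Q A)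
    → Confluent Q R ⇔ ChurchRosser Q R
mainTheorem1 Q L R = mk⇔ confluent⇒churchRosser churchRosser⇒confluent
  where open ChurchRosserProof Q (IsLawverian.commutative L) R
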